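{- Let $t$ be a plain term with resources and implicit names such that $t:[]$ is derivable in the $\mathcal{L}$-type system described in the context. Then $t$ is linear.
   Context: An ®-index is a pair $(n,\alpha)$ with $n\in\mathbb{N}$ and $\alpha$ a finite string over $\{0,1\}$ ($\varepsilon$ the empty string; $\alpha0,\alpha1$ denote $\alpha$ followed by $0$, resp. $1$). Plain terms: $t::=(n,\alpha)\mid\lambda t\mid t\,t\mid (n,\alpha)\odot t\mid (n,\alpha)\triangledown t$. Strings of booleans are ordered lexicographically from $0<1$ with $\varepsilon$ below every nonempty string, and ®-indices by the lexicographic product of the order on $\mathbb{N}$ and this order. $\mathcal{L}$-types are finite lists of ®-indices. Partial merge $\ddagger$: $[]\ddagger\ell=\ell$; $(x::\ell)\ddagger[]=x::\ell$; $(x_1::\ell_1)\ddagger(x_2::\ell_2)=x_1::(\ell_1\ddagger(x_2::\ell_2))$ if $x_1<x_2$, $=x_2::((x_1::\ell_1)\ddagger\ell_2)$ if $x_2<x_1$, undefined when the recursion reaches equal heads. Partial decrement, defined only on lists whose elements all have strictly positive first component: $\downarrow[]=[]$, $\downarrow((n+1,\alpha)::\ell)=(n,\alpha)::\downarrow\ell$. Typing rules (applicable only when the conclusion's list is defined): $(n,\alpha):[(n,\alpha)]$; if $t:(0,\varepsilon)::\ell$ then $\lambda t:\downarrow\ell$; if $t_1:\ell_1,t_2:\ell_2$ then $t_1t_2:\ell_1\ddagger\ell_2$; if $t:\ell$ then $(n,\alpha)\odot t:[(n,\alpha)]\ddagger\ell$; if $t:\ell\ddagger[(n,\alpha0),(n,\alpha1)]$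 then $(n,\alpha)\triangledown t:[(n,\alpha)]\ddagger\ell$. The multiset $FO(t)$ of free ®-index occurrences: $FO((n,\alpha))=\{(n,\alpha)\}$; $FO(t_1t_2)=FO(t_1)\uplus FO(t_2)$; $FO(\lambda s)=\{(n,\alpha):(n+1,\alpha)\in FO(s)\}$; $FO((n,\alpha)\odot s)=\{(n,\alpha)\}\uplus FO(s)$; $FO((n,\alpha)\triangledown s)=\{(n,\alpha)\}\uplus(FO(s)$ minus all occurrences of $(n,\alpha0),(n,\alpha1))$. A term $t$ is linear if all its ®-indices are bound and occur once and only once, i.e.: $FO(t)$ is empty; for every subterm $s$ no ®-index occurs more than once in $FO(s)$; for every subterm $\lambda s$, $(0,\varepsilon)\in FO(s)$ and no other ®-index with first component $0$ is in $FO(s)$; and for every subterm $(n,\alpha)\triangledown s$, both $(n,\alpha0)$ and $(n,\alpha1)$ are in $FO(s)$. -}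

module Defs where

open import Data.Nat using (ℕ; zero; suc) renaming (_<_ to _<ℕ_)
open import Data.Bool using (Bool; true; false)
open import Data.List using (List; []; _∷_; _++_; [_]; filter)
open import Data.Product using (_×_; _,_; proj₁; proj₂)
open import Relation.Binary.PropositionalEquality using (_≡_)
open import Relation.Nullary using (¬_; Dec; yes; no)
open import Relation.Nullary.Decidable using (_⊎-dec_; ¬?)
open import Relation.Binary.Definitions using (DecidableEquality)
import Data.Nat as ℕ
import Data.Bool as B
import Data.List.Properties as LP
import Data.Product.Properties as PP
open import Data.List.Relation.Unary.Unique.Propositional using (Unique)
open import Data.List.Membership.Propositional using (_∈_)

-- ®-indices (n , α), α a string of booleans (false = 0, true = 1)
Idx : Set
Idx = ℕ × List Bool

_·0 : List Bool → List Bool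
α ·0 = α ++ [ false ]

_·1 : List Bool → List Bool
α ·1 = α ++ [ true ]

data _<s_ : List Bool → List Bool → Set where
  ε<∷  : ∀ {b β} → [] <s (b ∷ β)
  0<1  : ∀ {α β} → (false ∷ α) <s (true ∷ β)
  same : ∀ {b α β} → α <s β → (b ∷ α) <s (b ∷ β)

data _<I_ : Idx → Idx → Set where
  fst< : ∀ {n m α β} → n <ℕ m → (n , α) <I (m , β)
  snd< : ∀ {n α β} → α <s β → (n , α) <I (n , β)

data Term : Set where
  var   : Idx → Term
  lam   : Term → Term
  app   : Term → Term → Term
  odot  : Idx → Term → Term
  nabla : Idx → Term → Term

-- graph of the partial merge ‡ : Merge ℓ₁ ℓ₂ ℓ  iff  ℓ₁ ‡ ℓ₂ is defined and equals ℓ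
data Merge : List Idx → List Idx → List Idx → Set where
  []‡  : ∀ {ℓ} → Merge [] ℓ ℓ
  ‡[]  : ∀ {x ℓ} → Merge (x ∷ ℓ) [] (x ∷ ℓ)
  lt   : ∀ {x₁ x₂ ℓ₁ ℓ₂ ℓ} → x₁ <I x₂ → Merge ℓ₁ (x₂ ∷ ℓ₂) ℓ →
         Merge (x₁ ∷ ℓ₁) (x₂ ∷ ℓ₂) (x₁ ∷ ℓ)
  gt   : ∀ {x₁ x₂ ℓ₁ ℓ₂ ℓ} → x₂ <I x₁ → Merge (x₁ ∷ ℓ₁) ℓ₂ ℓ →
         Merge (x₁ ∷ ℓ₁) (x₂ ∷ ℓ₂) (x₂ ∷ ℓ)

-- graph of the partial decrement ↓
data Decr : List Idx → List Idx → Set where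
  []↓ : Decr [] []
  ∷↓  : ∀ {n α ℓ ℓ'} → Decr ℓ ℓ' → Decr ((suc n , α) ∷ ℓ) ((n , α) ∷ ℓ')

data _∶_ : Term → List Idx → Set where
  ty-var   : ∀ {x} → var x ∶ [ x ]
  ty-lam   : ∀ {t ℓ ℓ'} → t ∶ ((0 , []) ∷ ℓ) → Decr ℓ ℓ' → lam t ∶ ℓ'
  ty-app   : ∀ {t₁ t₂ ℓ₁ ℓ₂ ℓ} → t₁ ∶ ℓ₁ → t₂ ∶ ℓ₂ → Merge ℓ₁ ℓ₂ ℓ → app t₁ t₂ ∶ ℓ
  ty-odot  : ∀ {n α t ℓ ℓ'} → t ∶ ℓ → Merge [ (n , α) ] ℓ ℓ' → odot (n , α) t ∶ ℓ'
  ty-nabla : ∀ {n α t ℓ ℓ₀ ℓ'} → Merge ℓ ((n , α ·0) ∷ (n , α ·1) ∷ []) ℓ₀ → t ∶ ℓ₀ →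
             Merge [ (n , α) ] ℓ ℓ' → nabla (n , α) t ∶ ℓ'

_≟I_ : DecidableEquality Idx
_≟I_ = PP.≡-dec ℕ._≟_ (LP.≡-dec B._≟_)

shiftDown : List Idx → List Idx
shiftDown [] = []
shiftDown ((zero , α) ∷ ℓ) = shiftDown ℓ
shiftDown ((suc n , α) ∷ ℓ) = (n , α) ∷ shiftDown ℓ

-- multiset (list) of free ®-index occurrences
FO : Term → List Idx
FO (var x) = [ x ]
FO (lam s) = shiftDown (FO s)
FO (app t₁ t₂) = FO t₁ ++ FO t₂
FO (odot x s) = x ∷ FO s
FO (nabla (n , α) s) =
  (n , α) ∷ filter (λ y → ¬? ((y ≟I (n , α ·0)) ⊎-dec (y ≟I (n , α ·1)))) (FO s)

data _≼_ : Term → Term → Set where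
  here   : ∀ {t} → t ≼ t
  inLam  : ∀ {s t} → s ≼ t → s ≼ lam t
  inAppˡ : ∀ {s t u} → s ≼ t → s ≼ app t u
  inAppʳ : ∀ {s t u} → s ≼ u → s ≼ app t u
  inOdot : ∀ {s x t} → s ≼ t → s ≼ odot x t
  inNabla : ∀ {s x t} → s ≼ t → s ≼ nabla x t

record Linear (t : Term) : Set where
  field
    closed    : FO t ≡ []
    once      : ∀ s → s ≼ t → Unique (FO s)
    lamBinds  : ∀ s → lam s ≼ t → (0 , []) ∈ FO s
    lamOnly   : ∀ s → lam s ≼ t → ∀ α → (0 , α) ∈ FO s → α ≡ []
    nablaUses : ∀ n α s → nabla (n , α) s ≼ t →
                ((n , α ·0) ∈ FO s) × ((n , α ·1) ∈ FO s)

-- Every derivable type is strictly increasing, hence duplicate-free, and the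
-- free occurrences of a typable term are a permutation of its type: merge is
-- a shuffle, decrement agrees with the shift of FO under λ, and the filter in
-- FO of ▽ removes exactly the two indices (n , α0), (n , α1) that the premise
-- merged in.  Linearity of a closed typable term is then read off the types
-- of its subterms, all of which are typable.
module Submission where

open import Defs
open import Data.List using ([])
open import Data.Nat using (zero; suc; s≤s)
import Data.Nat.Properties as ℕ
open import Data.List using (List; _∷_; _++_; filter)
open import Data.List.Properties using (++-identityʳ; filter-++; filter-all; filter-none)
open import Data.Product using (∃; _×_; _,_; proj₁; proj₂)
open import Data.Sum using (_⊎_; inj₁; inj₂)
open import Data.Empty using (⊥-elim)
open import Relation.Nullary using (¬_)
open import Relation.Binary.PropositionalEquality using (_≡_; _≢_; refl; cong; cong₂; setoid; module ≡-Reasoning)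
open import Relation.Nullary.Decidable using (_⊎-dec_; ¬?)
open import Data.List.Relation.Unary.All as All using (All; []; _∷_)
open import Data.List.Relation.Unary.All.Properties using (++⁻ʳ)
open import Data.List.Relation.Unary.Any using (here; there)
open import Data.List.Relation.Unary.AllPairs as AllPairs using (AllPairs; []; _∷_)
open import Data.List.Relation.Unary.Unique.Propositional using (Unique)
open import Data.List.Membership.Propositional using (_∈_; _∉_)
open import Data.List.Membership.Propositional.Properties using (∈-++⁺ʳ)
open import Data.List.Relation.Binary.Permutation.Propositional as ↭
  using (_↭_; prep; swap; ↭-refl; ↭-sym; ↭-reflexive; ↭-trans; ↭⇒↭ₛ)
open import Data.List.Relation.Binary.Permutation.Propositional.Properties
  using (↭-empty-inv; ∈-resp-↭; filter-↭; shift)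
  renaming (++⁺ to ↭-++⁺)
open import Data.List.Relation.Binary.Permutation.Setoid.Properties
  (setoid Idx) using (Unique-resp-↭)

<s-trans : ∀ {α β γ} → α <s β → β <s γ → α <s γ
<s-trans ε<∷      0<1      = ε<∷
<s-trans ε<∷      (same _) = ε<∷
<s-trans 0<1      (same _) = 0<1
<s-trans (same _) 0<1      = 0<1
<s-trans (same p) (same q) = same (<s-trans p q)

<s-irrefl : ∀ {α} → ¬ α <s α
<s-irrefl (same p) = <s-irrefl p

<I-trans : ∀ {x y z} → x <I y → y <I z → x <I z
<I-trans (fst< p) (fst< q) = fst< (ℕ.<-trans p q)
<I-trans (fst< p) (snd< _) = fst< p
<I-trans (snd< _) (fst< q) = fst< q
<I-trans (snd< p) (snd< q) = snd< (<s-trans p q)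

<I-irrefl : ∀ {x y} → x ≡ y → ¬ x <I y
<I-irrefl refl (fst< p) = ℕ.<-irrefl refl p
<I-irrefl refl (snd< p) = <s-irrefl p

Sorted : List Idx → Set
Sorted = AllPairs _<I_

Sorted⇒Unique : ∀ {xs} → Sorted xs → Unique xs
Sorted⇒Unique = AllPairs.map (λ x<y x≡y → <I-irrefl x≡y x<y)

Unique-++⇒apart : ∀ xs {ys : List Idx} → Unique (xs ++ ys) → All (λ x → All (x ≢_) ys) xs
Unique-++⇒apart []       _         = []
Unique-++⇒apart (x ∷ xs) (x∉ ∷ u) = ++⁻ʳ xs x∉ ∷ Unique-++⇒apart xs u

merge-All : ∀ {P : Idx → Set} {xs ys zs} → Merge xs ys zs → All P xs → All P ys → All P zs
merge-All []‡      _          pys        = pys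
merge-All ‡[]      pxs        _          = pxs
merge-All (lt _ m) (px ∷ pxs) pys        = px ∷ merge-All m pxs pys
merge-All (gt _ m) pxs        (py ∷ pys) = py ∷ merge-All m pxs pys

merge-Allˡ : ∀ {P : Idx → Set} {xs ys zs} → Merge xs ys zs → All P zs → All P xs
merge-Allˡ []‡      _          = []
merge-Allˡ ‡[]      pzs        = pzs
merge-Allˡ (lt _ m) (pz ∷ pzs) = pz ∷ merge-Allˡ m pzs
merge-Allˡ (gt _ m) (_ ∷ pzs)  = merge-Allˡ m pzs

merge-sorted : ∀ {xs ys zs} → Merge xs ys zs → Sorted xs → Sorted ys → Sorted zs
merge-sorted []‡ _ sys = sys
merge-sorted ‡[] sxs _ = sxs
merge-sorted (lt x<y m) (px ∷ sxs) (py ∷ sys) =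
  merge-All m px (x<y ∷ All.map (<I-trans x<y) py) ∷ merge-sorted m sxs (py ∷ sys)
merge-sorted (gt y<x m) (px ∷ sxs) (py ∷ sys) =
  merge-All m (y<x ∷ All.map (<I-trans y<x) px) py ∷ merge-sorted m (px ∷ sxs) sys

merge-sortedˡ : ∀ {xs ys zs} → Merge xs ys zs → Sorted zs → Sorted xs
merge-sortedˡ []‡      _          = []
merge-sortedˡ ‡[]      szs        = szs
merge-sortedˡ (lt _ m) (pz ∷ szs) = merge-Allˡ m pz ∷ merge-sortedˡ m szs
merge-sortedˡ (gt _ m) (_ ∷ szs)  = merge-sortedˡ m szs

merge-↭ : ∀ {xs ys zs} → Merge xs ys zs → zs ↭ xs ++ ys
merge-↭ []‡      = ↭-refl
merge-↭ ‡[]      = ↭-sym (↭-reflexive (++-identityʳ _))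
merge-↭ (lt _ m) = prep _ (merge-↭ m)
merge-↭ (gt {x₁} {x₂} {ℓ₁} {ℓ₂} _ m) =
  ↭-trans (prep x₂ (merge-↭ m)) (↭-sym (shift x₂ (x₁ ∷ ℓ₁) ℓ₂))

pred-<I : ∀ {n m α β} → (suc n , α) <I (suc m , β) → (n , α) <I (m , β)
pred-<I (fst< (s≤s p)) = fst< p
pred-<I (snd< p)       = snd< p

decr-All : ∀ {n α xs ys} → Decr xs ys →
           All ((suc n , α) <I_) xs → All ((n , α) <I_) ys
decr-All []↓     []       = []
decr-All (∷↓ d) (p ∷ ps) = pred-<I p ∷ decr-All d ps

decr-sorted : ∀ {xs ys} → Decr xs ys → Sorted xs → Sorted ys
decr-sorted []↓     []       = []
decr-sorted (∷↓ d) (p ∷ s) = decr-All d p ∷ decr-sorted d s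

decr⇒shiftDown : ∀ {xs ys} → Decr xs ys → shiftDown xs ≡ ys
decr⇒shiftDown []↓     = refl
decr⇒shiftDown (∷↓ d) = cong (_ ∷_) (decr⇒shiftDown d)

decr-∉ : ∀ {xs ys α} → Decr xs ys → (0 , α) ∉ xs
decr-∉ (∷↓ d) (here ())
decr-∉ (∷↓ d) (there p) = decr-∉ d p

shiftDown-↭ : ∀ {xs ys} → xs ↭ ys → shiftDown xs ↭ shiftDown ys
shiftDown-↭ ↭.refl                                = ↭-refl
shiftDown-↭ (prep (zero  , _) p)                  = shiftDown-↭ p
shiftDown-↭ (prep (suc _ , _) p)                  = prep _ (shiftDown-↭ p)
shiftDown-↭ (swap (zero  , _) (zero  , _) p)      = shiftDown-↭ p
shiftDown-↭ (swap (zero  , _) (suc _ , _) p)      = prep _ (shiftDown-↭ p)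
shiftDown-↭ (swap (suc _ , _) (zero  , _) p)      = prep _ (shiftDown-↭ p)
shiftDown-↭ (swap (suc _ , _) (suc _ , _) p)      = swap _ _ (shiftDown-↭ p)
shiftDown-↭ (↭.trans p q)                         = ↭-trans (shiftDown-↭ p) (shiftDown-↭ q)

typing-sorted : ∀ {t ℓ} → t ∶ ℓ → Sorted ℓ
typing-sorted ty-var = [] ∷ []
typing-sorted (ty-lam ⊢t d) with typing-sorted ⊢t
... | _ ∷ s = decr-sorted d s
typing-sorted (ty-app ⊢t₁ ⊢t₂ m) = merge-sorted m (typing-sorted ⊢t₁) (typing-sorted ⊢t₂)
typing-sorted (ty-odot ⊢t m)     = merge-sorted m ([] ∷ []) (typing-sorted ⊢t)
typing-sorted (ty-nabla m ⊢t m') =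
  merge-sorted m' ([] ∷ []) (merge-sortedˡ m (typing-sorted ⊢t))

filter-pair-removed : ∀ (a b : Idx) ℓ → All (λ x → All (x ≢_) (a ∷ b ∷ [])) ℓ →
  filter (λ y → ¬? ((y ≟I a) ⊎-dec (y ≟I b))) (ℓ ++ a ∷ b ∷ []) ≡ ℓ
filter-pair-removed a b ℓ apart = begin
  filter P? (ℓ ++ a ∷ b ∷ [])              ≡⟨ filter-++ P? ℓ _ ⟩
  filter P? ℓ ++ filter P? (a ∷ b ∷ [])    ≡⟨ cong₂ _++_ (filter-all P? (All.map ≢-both apart))
                                                         (filter-none P? (rejects-a ∷ rejects-b ∷ [])) ⟩
  ℓ ++ []                                  ≡⟨ ++-identityʳ ℓ ⟩
  ℓ                                        ∎
  where
  open ≡-Reasoning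
  P? = λ y → ¬? ((y ≟I a) ⊎-dec (y ≟I b))
  rejects-a : ¬ ¬ (a ≡ a ⊎ a ≡ b)
  rejects-a ¬a = ¬a (inj₁ refl)
  rejects-b : ¬ ¬ (b ≡ a ⊎ b ≡ b)
  rejects-b ¬b = ¬b (inj₂ refl)
  ≢-both : ∀ {x} → All (x ≢_) (a ∷ b ∷ []) → ¬ (x ≡ a ⊎ x ≡ b)
  ≢-both (x≢a ∷ _ ∷ []) (inj₁ x≡a) = x≢a x≡a
  ≢-both (_ ∷ x≢b ∷ []) (inj₂ x≡b) = x≢b x≡b

FO↭type : ∀ {t ℓ} → t ∶ ℓ → FO t ↭ ℓ
FO↭type ty-var              = ↭-refl
FO↭type (ty-lam ⊢t d)       = ↭-trans (shiftDown-↭ (FO↭type ⊢t)) (↭-reflexive (decr⇒shiftDown d))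
FO↭type (ty-app ⊢t₁ ⊢t₂ m)  = ↭-trans (↭-++⁺ (FO↭type ⊢t₁) (FO↭type ⊢t₂)) (↭-sym (merge-↭ m))
FO↭type (ty-odot ⊢t m)      = ↭-trans (prep _ (FO↭type ⊢t)) (↭-sym (merge-↭ m))
FO↭type (ty-nabla {n} {α} {ℓ = ℓ} m ⊢t m') =
  ↭-trans (prep _ (↭-trans (filter-↭ _ (↭-trans (FO↭type ⊢t) (merge-↭ m)))
                           (↭-reflexive (filter-pair-removed _ _ ℓ apart))))
          (↭-sym (merge-↭ m'))
  where
  apart : All (λ x → All (x ≢_) ((n , α ·0) ∷ (n , α ·1) ∷ [])) ℓ
  apart = Unique-++⇒apart ℓ
            (Unique-resp-↭ (↭⇒↭ₛ (merge-↭ m)) (Sorted⇒Unique (typing-sorted ⊢t)))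

typing-FO-Unique : ∀ {t ℓ} → t ∶ ℓ → Unique (FO t)
typing-FO-Unique ⊢t =
  Unique-resp-↭ (↭⇒↭ₛ (↭-sym (FO↭type ⊢t))) (Sorted⇒Unique (typing-sorted ⊢t))

∈-type⇒∈-FO : ∀ {t ℓ x} → t ∶ ℓ → x ∈ ℓ → x ∈ FO t
∈-type⇒∈-FO ⊢t = ∈-resp-↭ (↭-sym (FO↭type ⊢t))

subterm-typable : ∀ {s t ℓ} → s ≼ t → t ∶ ℓ → ∃ (s ∶_)
subterm-typable here        ⊢t                 = _ , ⊢t
subterm-typable (inLam p)   (ty-lam ⊢t _)      = subterm-typable p ⊢t
subterm-typable (inAppˡ p)  (ty-app ⊢t₁ _ _)   = subterm-typable p ⊢t₁
subterm-typable (inAppʳ p)  (ty-app _ ⊢t₂ _)   = subterm-typable p ⊢t₂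
subterm-typable (inOdot p)  (ty-odot ⊢t _)     = subterm-typable p ⊢t
subterm-typable (inNabla p) (ty-nabla _ ⊢t _)  = subterm-typable p ⊢t

lam-binds : ∀ {s ℓ} → lam s ∶ ℓ → (0 , []) ∈ FO s
lam-binds (ty-lam ⊢s _) = ∈-type⇒∈-FO ⊢s (here refl)

lam-binds-only : ∀ {s ℓ α} → lam s ∶ ℓ → (0 , α) ∈ FO s → α ≡ []
lam-binds-only (ty-lam ⊢s d) x∈ with ∈-resp-↭ (FO↭type ⊢s) x∈
... | here refl = refl
... | there x∈ℓ = ⊥-elim (decr-∉ d x∈ℓ)

nabla-uses : ∀ {n α s ℓ} → nabla (n , α) s ∶ ℓ →
             ((n , α ·0) ∈ FO s) × ((n , α ·1) ∈ FO s)
nabla-uses {n} {α} {s} (ty-nabla {ℓ = ℓ} m ⊢s _) =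
  ∈-FO (∈-++⁺ʳ ℓ (here refl)) , ∈-FO (∈-++⁺ʳ ℓ (there (here refl)))
  where
  ∈-FO : ∀ {x} → x ∈ ℓ ++ (n , α ·0) ∷ (n , α ·1) ∷ [] → x ∈ FO s
  ∈-FO x∈ = ∈-type⇒∈-FO ⊢s (∈-resp-↭ (↭-sym (merge-↭ m)) x∈)

proposition6 : (t : Term) → t ∶ [] → Linear t
proposition6 t ⊢t = record
  { closed    = ↭-empty-inv (FO↭type ⊢t)
  ; once      = λ s s≼t → typing-FO-Unique (typable s≼t)
  ; lamBinds  = λ s s≼t → lam-binds (typable s≼t)
  ; lamOnly   = λ s s≼t α → lam-binds-only (typable s≼t)
  ; nablaUses = λ n α s s≼t → nabla-uses (typable s≼t)
  }
  where
  typable : ∀ {s} (s≼t : s ≼ t) → s ∶ proj₁ (subterm-typable s≼t ⊢t)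
  typable s≼t = proj₂ (subterm-typable s≼t ⊢t)
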